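{- Let $d$ be a positive integer and let $t_1,\ldots,t_n\in\mathbb{R}$ be distinct real numbers. Then the following three matroids on the ground set $\binom{[n]}{2}$ coincide: (1) the cofactor rigidity matroid $\mathcal{C}^{d-2}_{d-1}(\mathbf{q})$ of the planar points $\mathbf{q}_i=(t_i,t_i^2)$, $i=1,\dots,n$, on the standard parabola; (2) the bar-and-joint rigidity matroid $\mathcal{R}_d(\mathbf{p})$ of the points $\mathbf{p}_i=(t_i,t_i^2,\dots,t_i^d)\in\mathbb{R}^d$, $i=1,\dots,n$, on the moment curve; (3) the hyperconnectivity matroid $\mathcal{H}_d$ of the vectors $(1,t_i,\dots,t_i^{d-1})\in\mathbb{R}^d$, $i=1,\dots,n$; moreover, if no $t_i$ equals zero, this hyperconnectivity matroid equals the hyperconnectivity matroid $\mathcal{H}_d$ of the vectors $(t_i,t_i^2,\dots,t_i^d)$, $i=1,\dots,n$.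
   Context: For a list $\mathbf{p}=(\mathbf{p}_1,\dots,\mathbf{p}_n)$ of points in $\mathbb{R}^d$, all matrices below have rows indexed by pairs $\{i,j\}\in\binom{[n]}{2}$ (with $i<j$) and $nd$ columns grouped into $n$ consecutive blocks of size $d$; the row $\{i,j\}$ is zero outside blocks $i$ and $j$. The bar-and-joint rigidity matrix $R(\mathbf{p})$ has $\mathbf{p}_i-\mathbf{p}_j$ in block $i$ and $\mathbf{p}_j-\mathbf{p}_i$ in block $j$; its row matroid (linear matroid of the rows, ground set $\binom{[n]}{2}$) is $\mathcal{R}_d(\mathbf{p})$. The hyperconnectivity matrix $H(\mathbf{p})$ has $\mathbf{p}_j$ in block $i$ and $-\mathbf{p}_i$ in block $j$; its row matroid is the hyperconnectivity matroid $\mathcal{H}_d(\mathbf{p})$. For points $\mathbf{q}_1,\dots,\mathbf{q}_n\in\mathbb{R}^2$, let $c(x,y)=(x^{d-1},x^{d-2}y,\dots,xy^{d-2},y^{d-1})\in\mathbb{R}^d$; the cofactor rigidity matrix $C_d(\mathbf{q})$ has $c(\mathbf{q}_i-\mathbf{q}_j)$ in block $i$ and $-c(\mathbf{q}_i-\mathbf{q}_j)$ in block $j$; its row matroid is the cofactor rigidity matroid $\mathcal{C}^{d-2}_{d-1}(\mathbf{q})$. -}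

module Defs where

open import Level using (Level; _⊔_) renaming (suc to lsuc)
open import Algebra.Bundles using (CommutativeRing)
open import Relation.Binary.Structures using (IsTotalOrder)
open import Relation.Nullary using (¬_; does)
open import Data.Product using (Σ; ∃; _×_; _,_)
open import Data.Nat using (ℕ; zero; suc; _∸_)
open import Data.Fin using (Fin; toℕ; _<_; _≟_)
open import Data.Fin.Properties using (_<?_)
open import Data.Bool using (Bool; true; false; if_then_else_)
open import Relation.Binary.PropositionalEquality using (_≡_)
open import Function.Bundles using (_⇔_)

-- An axiomatisation of the real numbers: a Dedekind-complete ordered field.
-- (Any model is isomorphic to ℝ.)
record CompleteOrderedField (c ℓ₁ ℓ₂ : Level) : Set (lsuc (c ⊔ ℓ₁ ⊔ ℓ₂)) where
  field
    commutativeRing : CommutativeRing c ℓ₁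
  open CommutativeRing commutativeRing public
  field
    _≤_          : Carrier → Carrier → Set ℓ₂
    isTotalOrder : IsTotalOrder _≈_ _≤_
    0≉1          : ¬ (0# ≈ 1#)
    inverse      : ∀ x → ¬ (x ≈ 0#) → Σ Carrier (λ y → x * y ≈ 1#)
    +-mono-≤     : ∀ {x y} z → x ≤ y → (x + z) ≤ (y + z)
    *-nonneg     : ∀ {x y} → 0# ≤ x → 0# ≤ y → 0# ≤ (x * y)
    complete     : (P : Carrier → Set c) → ∃ P → ∃ (λ b → ∀ x → P x → x ≤ b) →
                   ∃ (λ s → (∀ x → P x → x ≤ s) × (∀ b → (∀ x → P x → x ≤ b) → s ≤ b))

module _ {c ℓ₁ ℓ₂ : Level} (ℝ : CompleteOrderedField c ℓ₁ ℓ₂) where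
  open CompleteOrderedField ℝ

  pow : Carrier → ℕ → Carrier
  pow x zero    = 1#
  pow x (suc k) = x * pow x k

  sumFin : (n : ℕ) → (Fin n → Carrier) → Carrier
  sumFin zero    f = 0#
  sumFin (suc n) f = f Fin.zero + sumFin n (λ i → f (Fin.suc i))

  -- A "pair matrix": rows indexed by pairs i < j of Fin n, columns by (vertex v, coordinate a).
  -- PairMatrix n d i j v a is the entry in row {i,j}, column (block v, coordinate a).
  PairMatrix : ℕ → ℕ → Set c
  PairMatrix n d = Fin n → Fin n → Fin n → Fin d → Carrier

  pairMatrix : ∀ {n d} → (blockI blockJ : Fin n → Fin n → Fin d → Carrier) → PairMatrix n d
  pairMatrix blockI blockJ i j v a =
    if does (v ≟ i) then blockI i j a else (if does (v ≟ j) then blockJ i j a else 0#)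

  Independent : (n d : ℕ) → PairMatrix n d → (Fin n → Fin n → Bool) → Set (c ⊔ ℓ₁)
  Independent n d M S =
    (λc : Fin n → Fin n → Carrier) →
    (∀ i j → i < j → S i j ≡ false → λc i j ≈ 0#) →
    (∀ v a → sumFin n (λ i → sumFin n (λ j →
               if does (i <? j) then λc i j * M i j v a else 0#)) ≈ 0#) →
    ∀ i j → i < j → λc i j ≈ 0#

  SameMatroid : (n d d' : ℕ) → PairMatrix n d → PairMatrix n d' → Set (c ⊔ ℓ₁)
  SameMatroid n d d' M M' = ∀ (S : Fin n → Fin n → Bool) → Independent n d M S ⇔ Independent n d' M' S

  rigidityMatrix : ∀ {n d} → (Fin n → Fin d → Carrier) → PairMatrix n d
  rigidityMatrix p = pairMatrix (λ i j a → p i a - p j a) (λ i j a → p j a - p i a)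

  hyperMatrix : ∀ {n d} → (Fin n → Fin d → Carrier) → PairMatrix n d
  hyperMatrix p = pairMatrix (λ i j a → p j a) (λ i j a → - p i a)

  cvec : (d : ℕ) → Carrier → Carrier → Fin d → Carrier
  cvec d x y a = pow x (d ∸ suc (toℕ a)) * pow y (toℕ a)

  cofactorMatrix : ∀ {n} (d : ℕ) → (Fin n → Carrier) → (Fin n → Carrier) → PairMatrix n d
  cofactorMatrix d qx qy =
    pairMatrix (λ i j a → cvec d (qx i - qx j) (qy i - qy j) a)
               (λ i j a → - cvec d (qx i - qx j) (qy i - qy j) a)

-- After multiplying each row {i,j} by a scalar s_{ij}, invertible because the t_i are distinct
-- (resp. nonzero), each of the four matrices has row {i,j} equal to p_{i,a}(t_j) in block i and
-- −p_{j,a}(t_i) in block j (a < d), where for every vertex v the polynomials p_{v,0}, …, p_{v,d−1}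
-- form a basis of the polynomials of degree < d:
--   rigidity:  t_i^(a+1) − t_j^(a+1) = (t_i − t_j) h_a(t_i, t_j), so p_{v,a}(x) = h_a(t_v, x) with
--              h_a the complete homogeneous polynomial;
--   cofactor:  (t_i − t_j)^(d−1−a) (t_i² − t_j²)^a = (t_i − t_j)^(d−1) (t_j + t_i)^a,
--              so p_{v,a}(x) = (x + t_v)^a;
--   hyperconnectivity:  p_{v,a}(x) = x^a, resp. x^a / t_v with s_{ij} = t_i t_j.
-- Rescaling rows by invertible scalars does not change the row matroid. Coefficients λ give a
-- dependency among the rows of such a matrix exactly when, for every v, the linear functional
-- f ↦ Σ_{j>v} λ_{vj} f(t_j) − Σ_{i<v} λ_{iv} f(t_i) kills p_{v,0}, …, p_{v,d−1}, i.e. kills every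
-- polynomial of degree < d, a condition that does not depend on the basis.
module Submission where

open import Defs
open CompleteOrderedField using (Carrier) renaming (_≈_ to eqR; 0# to zeroR)
open import Data.Nat using (ℕ; zero; suc; _≤_)
open import Data.Fin using (Fin; toℕ)
open import Data.Product using (_×_)
open import Relation.Nullary using (¬_)
open import Relation.Binary.PropositionalEquality using (_≡_)
open import Function.Bundles using (_⇔_)

open import Algebra.Bundles using (CommutativeRing; RawRing)
open import Data.Bool using (if_then_else_)
open import Data.Fin using (_<_; _≟_; fromℕ<)
open import Data.Fin.Properties using (_<?_; toℕ<n; toℕ-fromℕ<; <-irrefl)
open import Data.Maybe using (Maybe; just; nothing)
import Data.Nat as ℕ
open import Data.Nat using (_∸_)
open import Data.Nat.Properties using (≤-refl; ≤-trans; n≤1+n; m≤n⇒m≤1+n; m∸n+n≡m)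
open import Data.Product using (Σ; _,_; proj₁; proj₂)
open import Function.Bundles using (mk⇔)
open import Function.Properties.Equivalence using (⇔-isEquivalence)
open import Level using (0ℓ; _⊔_)
open import Relation.Binary.Structures using (IsEquivalence)
open import Relation.Nullary using (Dec; yes; no; does; contradiction)
import Relation.Binary.PropositionalEquality as ≡

module RingSolver {c ℓ} (R : CommutativeRing c ℓ) where
  open CommutativeRing R renaming (Carrier to A)
  open import Algebra.Properties.Ring ring
    using (-‿distribˡ-*; -‿distribʳ-*; -‿involutive; -‿+-comm; -0#≈0#)
  open import Algebra.Properties.Semiring.Mult semiring using (×-homo-+; ×1-homo-*) renaming (_×_ to _·_)
  open import Algebra.Properties.CommutativeSemigroup +-commutativeSemigroup using (interchange)
  open import Algebra.Solver.Ring.AlmostCommutativeRing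
    using (fromCommutativeRing; _-Raw-AlmostCommutative⟶_)
  open import Relation.Binary.Reasoning.Setoid setoid

  -- The pair (m , n) stands for the integer m − n; integer coefficients let the solver cancel terms.
  differences : RawRing 0ℓ 0ℓ
  differences = record
    { Carrier = ℕ × ℕ
    ; _≈_     = _≡_
    ; _+_     = λ { (a , b) (c , d) → a ℕ.+ c , b ℕ.+ d }
    ; _*_     = λ { (a , b) (c , d) → a ℕ.* c ℕ.+ b ℕ.* d , a ℕ.* d ℕ.+ b ℕ.* c }
    ; -_      = λ { (a , b) → b , a }
    ; 0#      = 0 , 0
    ; 1#      = 1 , 0
    }

  embed : ℕ × ℕ → A
  embed (m , n) = m · 1# - n · 1#

  [a+c]-[b+d]≈[a-b]+[c-d] : ∀ a b c d → (a + c) - (b + d) ≈ (a - b) + (c - d)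
  [a+c]-[b+d]≈[a-b]+[c-d] a b c d = trans (+-congˡ (sym (-‿+-comm b d))) (interchange a c (- b) (- d))

  [ac+bd]-[ad+bc]≈[a-b][c-d] : ∀ a b c d → (a * c + b * d) - (a * d + b * c) ≈ (a - b) * (c - d)
  [ac+bd]-[ad+bc]≈[a-b][c-d] a b c d = begin
    (a * c + b * d) - (a * d + b * c)          ≈⟨ [a+c]-[b+d]≈[a-b]+[c-d] _ _ _ _ ⟩
    (a * c - a * d) + (b * d - b * c)          ≈⟨ +-cong (+-congˡ (-‿distribʳ-* a d)) (+-comm _ _) ⟩
    (a * c + a * - d) + (- (b * c) + b * d)    ≈⟨ +-cong (sym (distribˡ a c (- d)))
                                                          (+-cong (-‿distribˡ-* b c) -b*-d) ⟩
    a * (c - d) + (- b * c + - b * - d)        ≈⟨ +-congˡ (sym (distribˡ (- b) c (- d))) ⟩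
    a * (c - d) + - b * (c - d)                ≈⟨ sym (distribʳ (c - d) a (- b)) ⟩
    (a - b) * (c - d)                          ∎
    where
    -b*-d : b * d ≈ - b * - d
    -b*-d = sym (trans (sym (-‿distribˡ-* b (- d)))
                       (trans (-‿cong (sym (-‿distribʳ-* b d))) (-‿involutive (b * d))))

  a+d≈c+b⇒a-b≈c-d : ∀ {a b c d} → a + d ≈ c + b → a - b ≈ c - d
  a+d≈c+b⇒a-b≈c-d {a} {b} {c} {d} a+d≈c+b = begin
    a - b              ≈⟨ sym (+-identityʳ _) ⟩
    (a - b) + 0#       ≈⟨ +-congˡ (sym (-‿inverseʳ d)) ⟩
    (a - b) + (d - d)  ≈⟨ sym ([a+c]-[b+d]≈[a-b]+[c-d] a b d d) ⟩
    (a + d) - (b + d)  ≈⟨ +-cong a+d≈c+b (-‿cong (+-comm b d)) ⟩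
    (c + b) - (d + b)  ≈⟨ [a+c]-[b+d]≈[a-b]+[c-d] c d b b ⟩
    (c - d) + (b - b)  ≈⟨ +-congˡ (-‿inverseʳ b) ⟩
    (c - d) + 0#       ≈⟨ +-identityʳ _ ⟩
    c - d              ∎

  embed-homomorphism : differences -Raw-AlmostCommutative⟶ fromCommutativeRing R
  embed-homomorphism = record
    { ⟦_⟧    = embed
    ; +-homo = λ { (a , b) (c , d) →
        trans (+-cong (×-homo-+ 1# a c) (-‿cong (×-homo-+ 1# b d))) ([a+c]-[b+d]≈[a-b]+[c-d] _ _ _ _) }
    ; *-homo = λ { (a , b) (c , d) →
        trans (+-cong (trans (×-homo-+ 1# (a ℕ.* c) (b ℕ.* d))
                             (+-cong (×1-homo-* a c) (×1-homo-* b d)))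
                      (-‿cong (trans (×-homo-+ 1# (a ℕ.* d) (b ℕ.* c))
                                     (+-cong (×1-homo-* a d) (×1-homo-* b c)))))
              ([ac+bd]-[ad+bc]≈[a-b][c-d] _ _ _ _) }
    ; -‿homo = λ { (a , b) →
        trans (+-comm _ _) (trans (+-congˡ (sym (-‿involutive _))) (-‿+-comm _ _)) }
    ; 0-homo = -‿inverseʳ 0#
    ; 1-homo = trans (+-cong (+-identityʳ 1#) -0#≈0#) (+-identityʳ 1#)
    }

  embed-≟ : ∀ p q → Maybe (embed p ≈ embed q)
  embed-≟ (a , b) (c , d) with a ℕ.+ d ℕ.≟ c ℕ.+ b
  ... | yes a+d≡c+b = just (a+d≈c+b⇒a-b≈c-d
    (trans (sym (×-homo-+ 1# a d)) (trans (reflexive (≡.cong (_· 1#) a+d≡c+b)) (×-homo-+ 1# c b))))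
  ... | no _ = nothing

  open import Algebra.Solver.Ring differences (fromCommutativeRing R) embed-homomorphism embed-≟ public

module MomentCurve {c ℓ₁ ℓ₂} (ℝ : CompleteOrderedField c ℓ₁ ℓ₂) where
  open CompleteOrderedField ℝ renaming (Carrier to K) hiding (_≤_)
  open import Algebra.Properties.Ring ring using (-‿distribʳ-*; -‿+-comm; x∙y⁻¹≈ε⇒x≈y)
  open import Algebra.Properties.CommutativeSemigroup *-commutativeSemigroup using (x∙yz≈y∙xz)
  open import Algebra.Properties.CommutativeSemiring.Exp commutativeSemiring
    using (_^_; ^-congˡ; ^-homo-*; ^-distrib-*)
  open import Algebra.Properties.Semiring.Sum semiring using (sum; sum-cong-≋; ∑-distrib-+; *-distribˡ-sum)
  open import Relation.Binary.Reasoning.Setoid setoid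
  open RingSolver commutativeRing using (solve; _:+_; _:*_; _:-_; :-_; _:=_)

  pow≈^ : ∀ x k → pow ℝ x k ≈ x ^ k
  pow≈^ x zero    = refl
  pow≈^ x (suc k) = *-congˡ (pow≈^ x k)

  pow-congˡ : ∀ k {x y} → x ≈ y → pow ℝ x k ≈ pow ℝ y k
  pow-congˡ k {x} {y} x≈y = trans (pow≈^ x k) (trans (^-congˡ k x≈y) (sym (pow≈^ y k)))

  sumFin≡sum : ∀ m (f : Fin m → K) → sumFin ℝ m f ≡ sum f
  sumFin≡sum zero    f = ≡.refl
  sumFin≡sum (suc m) f = ≡.cong (f Fin.zero +_) (sumFin≡sum m _)

  sumFin-cong : ∀ m {f g : Fin m → K} → (∀ i → f i ≈ g i) → sumFin ℝ m f ≈ sumFin ℝ m g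
  sumFin-cong m {f} {g} f≈g rewrite sumFin≡sum m f | sumFin≡sum m g = sum-cong-≋ f≈g

  sumFin-distrib-+ : ∀ m (f g : Fin m → K) →
                     sumFin ℝ m (λ i → f i + g i) ≈ sumFin ℝ m f + sumFin ℝ m g
  sumFin-distrib-+ m f g
    rewrite sumFin≡sum m (λ i → f i + g i) | sumFin≡sum m f | sumFin≡sum m g = ∑-distrib-+ f g

  *-distribˡ-sumFin : ∀ m r (f : Fin m → K) → r * sumFin ℝ m f ≈ sumFin ℝ m (λ i → r * f i)
  *-distribˡ-sumFin m r f
    rewrite sumFin≡sum m f | sumFin≡sum m (λ i → r * f i) = *-distribˡ-sum r f

  guarded : ∀ {p} {P : Set p} → Dec P → K → K
  guarded P? x = if does P? then x else 0#

  guarded-cong : ∀ {p} {P : Set p} (P? : Dec P) {x y} → (P → x ≈ y) → guarded P? x ≈ guarded P? y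
  guarded-cong (yes p) x≈y = x≈y p
  guarded-cong (no _)  _   = refl

  guarded-+ : ∀ {p} {P : Set p} (P? : Dec P) x y → guarded P? (x + y) ≈ guarded P? x + guarded P? y
  guarded-+ (yes _) x y = refl
  guarded-+ (no _)  x y = sym (+-identityˡ 0#)

  *-guarded : ∀ {p} {P : Set p} (P? : Dec P) r x → r * guarded P? x ≈ guarded P? (r * x)
  *-guarded (yes _) r x = refl
  *-guarded (no _)  r x = zeroʳ r

  Invertible : K → Set (c ⊔ ℓ₁)
  Invertible x = Σ K (λ y → x * y ≈ 1#)

  invertible-1# : Invertible 1#
  invertible-1# = 1# , *-identityˡ 1#

  invertible-* : ∀ {x y} → Invertible x → Invertible y → Invertible (x * y)
  invertible-* {x} {y} (x⁻¹ , xx⁻¹≈1) (y⁻¹ , yy⁻¹≈1) = x⁻¹ * y⁻¹ , (begin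
    (x * y) * (x⁻¹ * y⁻¹) ≈⟨ solve 4 (λ x y x⁻¹ y⁻¹ → (x :* y) :* (x⁻¹ :* y⁻¹) := (x :* x⁻¹) :* (y :* y⁻¹))
                                     refl x y x⁻¹ y⁻¹ ⟩
    (x * x⁻¹) * (y * y⁻¹) ≈⟨ *-cong xx⁻¹≈1 yy⁻¹≈1 ⟩
    1# * 1#               ≈⟨ *-identityˡ 1# ⟩
    1#                    ∎)

  invertible-pow : ∀ k {x} → Invertible x → Invertible (pow ℝ x k)
  invertible-pow zero    _     = invertible-1#
  invertible-pow (suc k) x-inv = invertible-* x-inv (invertible-pow k x-inv)

  invertible-cancelʳ : ∀ {x z} → Invertible x → z * x ≈ 0# → z ≈ 0#
  invertible-cancelʳ {x} {z} (y , xy≈1) zx≈0 = begin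
    z            ≈⟨ sym (*-identityʳ z) ⟩
    z * 1#       ≈⟨ *-congˡ (sym xy≈1) ⟩
    z * (x * y)  ≈⟨ sym (*-assoc z x y) ⟩
    (z * x) * y  ≈⟨ *-congʳ zx≈0 ⟩
    0# * y       ≈⟨ zeroˡ y ⟩
    0#           ∎

  Fn : Set c
  Fn = K → K

  data Span (g : ℕ → Fn) (k : ℕ) : Fn → Set (c ⊔ ℓ₁) where
    gen   : ∀ {b} → b ℕ.< k → Span g k (g b)
    null  : Span g k (λ _ → 0#)
    add   : ∀ {f h} → Span g k f → Span g k h → Span g k (λ x → f x + h x)
    scale : ∀ {f} r → Span g k f → Span g k (λ x → r * f x)
    resp  : ∀ {f h} → (∀ x → f x ≈ h x) → Span g k f → Span g k h

  Span-trans : ∀ {g g′ k k′ f} → Span g k f → (∀ {b} → b ℕ.< k → Span g′ k′ (g b)) → Span g′ k′ f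
  Span-trans (gen b<k)   g⊆ = g⊆ b<k
  Span-trans null        g⊆ = null
  Span-trans (add p q)   g⊆ = add (Span-trans p g⊆) (Span-trans q g⊆)
  Span-trans (scale r p) g⊆ = scale r (Span-trans p g⊆)
  Span-trans (resp e p)  g⊆ = resp e (Span-trans p g⊆)

  Span-mono : ∀ {g k k′ f} → k ≤ k′ → Span g k f → Span g k′ f
  Span-mono k≤k′ p = Span-trans p (λ b<k → gen (≤-trans b<k k≤k′))

  record IsLinear (φ : Fn → K) : Set (c ⊔ ℓ₁) where
    field
      cong   : ∀ {f h} → (∀ x → f x ≈ h x) → φ f ≈ φ h
      homo-+ : ∀ f h → φ (λ x → f x + h x) ≈ φ f + φ h
      homo-* : ∀ r f → φ (λ x → r * f x) ≈ r * φ f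

  vanishes-on-Span : ∀ {φ g k f} → IsLinear φ → (∀ {b} → b ℕ.< k → φ (g b) ≈ 0#) →
                     Span g k f → φ f ≈ 0#
  vanishes-on-Span {φ} {g} {k} φ-linear φg≈0 = go
    where
    open IsLinear φ-linear
    go : ∀ {f} → Span g k f → φ f ≈ 0#
    go (gen b<k)   = φg≈0 b<k
    go null        = trans (cong (λ _ → sym (zeroˡ 0#))) (trans (homo-* 0# _) (zeroˡ _))
    go (add p q)   = trans (homo-+ _ _) (trans (+-cong (go p) (go q)) (+-identityˡ 0#))
    go (scale r p) = trans (homo-* r _) (trans (*-congˡ (go p)) (zeroʳ r))
    go (resp e p)  = trans (sym (cong e)) (go p)

  monomial : ℕ → Fn
  monomial a x = pow ℝ x a

  record TriangularBasis (g : ℕ → Fn) : Set (c ⊔ ℓ₁) where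
    field
      ∈-monomials : ∀ a → Span monomial (suc a) (g a)
      monomial-∈  : ∀ a → Span g (suc a) (monomial a)
  open TriangularBasis

  triangular-span : ∀ {g g′} → TriangularBasis g → TriangularBasis g′ →
                    ∀ {a d} → a ℕ.< d → Span g′ d (g a)
  triangular-span B B′ a<d =
    Span-trans (∈-monomials B _) (λ b<1+a → Span-mono (≤-trans b<1+a a<d) (monomial-∈ B′ _))

  monomial-triangular : TriangularBasis monomial
  monomial-triangular = record { ∈-monomials = λ _ → gen ≤-refl ; monomial-∈ = λ _ → gen ≤-refl }

  -- completeHomogeneous c a x = Σ_{k ≤ a} c^(a−k) x^k
  completeHomogeneous : K → ℕ → Fn
  completeHomogeneous c zero    x = 1#
  completeHomogeneous c (suc a) x = c * completeHomogeneous c a x + pow ℝ x (suc a)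

  completeHomogeneous-triangular : ∀ c → TriangularBasis (completeHomogeneous c)
  completeHomogeneous-triangular c = record { ∈-monomials = h∈ ; monomial-∈ = monomial∈ }
    where
    h∈ : ∀ a → Span monomial (suc a) (completeHomogeneous c a)
    h∈ zero    = gen ≤-refl
    h∈ (suc a) = add (scale c (Span-mono (n≤1+n _) (h∈ a))) (gen ≤-refl)
    monomial∈ : ∀ a → Span (completeHomogeneous c) (suc a) (monomial a)
    monomial∈ zero    = gen ≤-refl
    monomial∈ (suc a) = resp cancel (add (gen ≤-refl) (scale (- c) (gen (n≤1+n _))))
      where
      cancel : ∀ x → completeHomogeneous c (suc a) x + - c * completeHomogeneous c a x ≈ pow ℝ x (suc a)
      cancel x = solve 3 (λ c h X → (c :* h :+ X) :+ (:- c) :* h := X)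
                         refl c (completeHomogeneous c a x) (pow ℝ x (suc a))

  pow-difference : ∀ x y a → pow ℝ x (suc a) - pow ℝ y (suc a) ≈ (x - y) * completeHomogeneous x a y
  pow-difference x y zero    = trans (+-cong (*-identityʳ x) (-‿cong (*-identityʳ y))) (sym (*-identityʳ _))
  pow-difference x y (suc a) = begin
      x * X - y * Y                   ≈⟨ solve 4 (λ x y X Y → x :* X :- y :* Y
                                                             := x :* (X :- Y) :+ (x :- y) :* Y)
                                                 refl x y X Y ⟩
      x * (X - Y) + (x - y) * Y       ≈⟨ +-congʳ (*-congˡ (pow-difference x y a)) ⟩
      x * ((x - y) * H) + (x - y) * Y ≈⟨ solve 4 (λ x y H Y → x :* ((x :- y) :* H) :+ (x :- y) :* Y
                                                             := (x :- y) :* (x :* H :+ Y))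
                                                 refl x y H Y ⟩
      (x - y) * (x * H + Y)           ∎
    where X = pow ℝ x (suc a) ; Y = pow ℝ y (suc a) ; H = completeHomogeneous x a y

  shifted : K → ℕ → Fn
  shifted c a x = pow ℝ (x + c) a

  Span-*-shifted : ∀ c c′ {k f} → Span (shifted c) k f → Span (shifted c) (suc k) (λ x → (x + c′) * f x)
  Span-*-shifted c c′ (gen {b} b<k) =
    resp expand (add (gen (ℕ.s≤s b<k)) (scale (c′ - c) (gen (m≤n⇒m≤1+n b<k))))
    where
    expand : ∀ x → pow ℝ (x + c) (suc b) + (c′ - c) * pow ℝ (x + c) b ≈ (x + c′) * pow ℝ (x + c) b
    expand x = solve 4 (λ x c c′ P → (x :+ c) :* P :+ (c′ :- c) :* P := (x :+ c′) :* P)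
                       refl x c c′ (pow ℝ (x + c) b)
  Span-*-shifted c c′ null        = resp (λ _ → sym (zeroʳ _)) null
  Span-*-shifted c c′ (add p q)   =
    resp (λ _ → sym (distribˡ _ _ _)) (add (Span-*-shifted c c′ p) (Span-*-shifted c c′ q))
  Span-*-shifted c c′ (scale r p) = resp (λ x → x∙yz≈y∙xz r (x + c′) _) (scale r (Span-*-shifted c c′ p))
  Span-*-shifted c c′ (resp e p)  = resp (λ x → *-congˡ (e x)) (Span-*-shifted c c′ p)

  shifted-span : ∀ c c′ a → Span (shifted c) (suc a) (shifted c′ a)
  shifted-span c c′ zero    = gen ≤-refl
  shifted-span c c′ (suc a) = Span-*-shifted c c′ (shifted-span c c′ a)

  shifted-0# : ∀ a x → shifted 0# a x ≈ monomial a x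
  shifted-0# a x = pow-congˡ a (+-identityʳ x)

  shifted-triangular : ∀ c → TriangularBasis (shifted c)
  shifted-triangular c = record
    { ∈-monomials = λ a → Span-trans (shifted-span 0# c a)
                                      (λ {b} b<k → resp (λ x → sym (shifted-0# b x)) (gen b<k))
    ; monomial-∈  = λ a → resp (shifted-0# a) (shifted-span c 0# a)
    }

  scaledMonomial : K → ℕ → Fn
  scaledMonomial w a x = pow ℝ x a * w

  scaledMonomial-triangular : ∀ {u w} → u * w ≈ 1# → TriangularBasis (scaledMonomial w)
  scaledMonomial-triangular {u} {w} uw≈1 = record
    { ∈-monomials = λ a → resp (λ x → *-comm w _) (scale w (gen ≤-refl))
    ; monomial-∈  = λ a → resp (λ x → trans (x∙yz≈y∙xz u _ w) (trans (*-congˡ uw≈1) (*-identityʳ _)))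
                                (scale u (gen ≤-refl))
    }

  cvec-parabola : ∀ {d} x y (a : Fin d) →
                  cvec ℝ d (x - y) (pow ℝ x 2 - pow ℝ y 2) a ≈ pow ℝ (x - y) (d ∸ 1) * pow ℝ (y + x) (toℕ a)
  cvec-parabola {d} x y a = begin
    pow ℝ E m * pow ℝ (pow ℝ x 2 - pow ℝ y 2) a′ ≈⟨ *-cong (pow≈^ E m) (pow≈^ _ a′) ⟩
    E ^ m * (pow ℝ x 2 - pow ℝ y 2) ^ a′       ≈⟨ *-congˡ (^-congˡ a′ x²-y²≈EF) ⟩
    E ^ m * (E * F) ^ a′                       ≈⟨ *-congˡ (^-distrib-* E F a′) ⟩
    E ^ m * (E ^ a′ * F ^ a′)                  ≈⟨ sym (*-assoc _ _ _) ⟩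
    (E ^ m * E ^ a′) * F ^ a′                  ≈⟨ *-congʳ (sym (^-homo-* E m a′)) ⟩
    E ^ (m ℕ.+ a′) * F ^ a′                    ≡⟨ ≡.cong (λ k → E ^ k * F ^ a′) (exponent (toℕ<n a)) ⟩
    E ^ (d ∸ 1) * F ^ a′                       ≈⟨ sym (*-cong (pow≈^ E (d ∸ 1)) (pow≈^ F a′)) ⟩
    pow ℝ E (d ∸ 1) * pow ℝ F a′               ∎
    where
    a′ = toℕ a ; m = d ∸ suc a′ ; E = x - y ; F = y + x
    x²-y²≈EF : pow ℝ x 2 - pow ℝ y 2 ≈ E * F
    x²-y²≈EF = trans (+-cong (*-congˡ (*-identityʳ x)) (-‿cong (*-congˡ (*-identityʳ y))))
                     (solve 2 (λ x y → x :* x :- y :* y := (x :- y) :* (y :+ x)) refl x y)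
    exponent : ∀ {b d} → b ℕ.< d → d ∸ suc b ℕ.+ b ≡ d ∸ 1
    exponent (ℕ.s≤s b≤d) = m∸n+n≡m b≤d

  rescale-by-inverse : ∀ {x w} → x * w ≈ 1# → ∀ y z → y * z ≈ (x * y) * (z * w)
  rescale-by-inverse {x} {w} xw≈1 y z = sym (begin
    (x * y) * (z * w)  ≈⟨ solve 4 (λ x y z w → (x :* y) :* (z :* w) := (x :* w) :* (y :* z)) refl x y z w ⟩
    (x * w) * (y * z)  ≈⟨ *-congʳ xw≈1 ⟩
    1# * (y * z)       ≈⟨ *-identityˡ _ ⟩
    y * z              ∎)

  module _ {n : ℕ} where

    Row : Set c
    Row = Fin n → Fin n → K

    ΣPairs : Row → K
    ΣPairs w = sumFin ℝ n (λ i → sumFin ℝ n (λ j → guarded (i <? j) (w i j)))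

    ΣPairs-cong : ∀ {w w′} → (∀ i j → i < j → w i j ≈ w′ i j) → ΣPairs w ≈ ΣPairs w′
    ΣPairs-cong w≈w′ = sumFin-cong n (λ i → sumFin-cong n (λ j → guarded-cong (i <? j) (w≈w′ i j)))

    ΣPairs-+ : ∀ w w′ → ΣPairs (λ i j → w i j + w′ i j) ≈ ΣPairs w + ΣPairs w′
    ΣPairs-+ w w′ = trans (sumFin-cong n (λ i → trans (sumFin-cong n (λ j → guarded-+ (i <? j) _ _))
                                                      (sumFin-distrib-+ n _ _)))
                          (sumFin-distrib-+ n _ _)

    ΣPairs-* : ∀ r w → ΣPairs (λ i j → r * w i j) ≈ r * ΣPairs w
    ΣPairs-* r w = sym (trans (*-distribˡ-sumFin n r _)
                              (sumFin-cong n (λ i → trans (*-distribˡ-sumFin n r _)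
                                                          (sumFin-cong n (λ j → *-guarded (i <? j) r _)))))

    InvertibleOnPairs : Row → Set (c ⊔ ℓ₁)
    InvertibleOnPairs s = ∀ i j → i < j → Invertible (s i j)

    inverseOnPairs : ∀ {s} → InvertibleOnPairs s → Row
    inverseOnPairs s-inv i j with i <? j
    ... | yes i<j = proj₁ (s-inv i j i<j)
    ... | no  _   = 0#

    inverseOnPairs-inverseˡ : ∀ {s} (s-inv : InvertibleOnPairs s) → ∀ i j → i < j →
                              inverseOnPairs s-inv i j * s i j ≈ 1#
    inverseOnPairs-inverseˡ s-inv i j i<j with i <? j
    ... | yes i<j′ = trans (*-comm _ _) (proj₂ (s-inv i j i<j′))
    ... | no  i≮j  = contradiction i<j i≮j

    module _ {d : ℕ} where

      Independent-resp : ∀ {M M′ S} → (∀ i j → i < j → ∀ v a → M i j v a ≈ M′ i j v a) →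
                         Independent ℝ n d M S → Independent ℝ n d M′ S
      Independent-resp M≈M′ ind λc outside dependency =
        ind λc outside (λ v a → trans (ΣPairs-cong (λ i j i<j → *-congˡ (M≈M′ i j i<j v a)))
                                      (dependency v a))

      ≈⇒SameMatroid : ∀ {M M′} → (∀ i j → i < j → ∀ v a → M i j v a ≈ M′ i j v a) →
                      SameMatroid ℝ n d d M M′
      ≈⇒SameMatroid M≈M′ S =
        mk⇔ (Independent-resp M≈M′) (Independent-resp (λ i j i<j v a → sym (M≈M′ i j i<j v a)))

      SameMatroid-sym : ∀ {M M′} → SameMatroid ℝ n d d M M′ → SameMatroid ℝ n d d M′ M
      SameMatroid-sym M~M′ S = IsEquivalence.sym ⇔-isEquivalence (M~M′ S)

      SameMatroid-trans : ∀ {M M′ M″} → SameMatroid ℝ n d d M M′ → SameMatroid ℝ n d d M′ M″ →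
                          SameMatroid ℝ n d d M M″
      SameMatroid-trans M~M′ M′~M″ S = IsEquivalence.trans ⇔-isEquivalence (M~M′ S) (M′~M″ S)

      scaleRows : Row → PairMatrix ℝ n d → PairMatrix ℝ n d
      scaleRows s M i j v a = s i j * M i j v a

      Independent-scaleRows : ∀ {s M S} → InvertibleOnPairs s →
                              Independent ℝ n d M S → Independent ℝ n d (scaleRows s M) S
      Independent-scaleRows {s} s-inv ind λc outside dependency i j i<j =
        invertible-cancelʳ (s-inv i j i<j) (ind (λ i j → λc i j * s i j) outside′ dependency′ i j i<j)
        where
        outside′ = λ i j i<j Sij≡false → trans (*-congʳ (outside i j i<j Sij≡false)) (zeroˡ _)
        dependency′ = λ v a → trans (ΣPairs-cong (λ i j _ → *-assoc _ _ _)) (dependency v a)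

      SameMatroid-scaleRows : ∀ {s M} → InvertibleOnPairs s → SameMatroid ℝ n d d M (scaleRows s M)
      SameMatroid-scaleRows {s} s-inv S = mk⇔ (Independent-scaleRows s-inv) unscale
        where
        s⁻¹-inv : InvertibleOnPairs (inverseOnPairs s-inv)
        s⁻¹-inv i j i<j = s i j , inverseOnPairs-inverseˡ s-inv i j i<j
        unscale = λ ind → Independent-resp
          (λ i j i<j v a → trans (sym (*-assoc _ _ _))
                                 (trans (*-congʳ (inverseOnPairs-inverseˡ s-inv i j i<j)) (*-identityˡ _)))
          (Independent-scaleRows s⁻¹-inv ind)

      pairMatrix-scaled : ∀ {A B A′ B′ : Fin n → Fin n → Fin d → K} {s : Row} →
                          (∀ i j a → A i j a ≈ s i j * A′ i j a) → (∀ i j a → B i j a ≈ s i j * B′ i j a) →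
                          ∀ i j v a → pairMatrix ℝ A B i j v a ≈ scaleRows s (pairMatrix ℝ A′ B′) i j v a
      pairMatrix-scaled A≈ B≈ i j v a with v ≟ i
      ... | yes ≡.refl = A≈ v j a
      ... | no  _ with v ≟ j
      ...   | yes ≡.refl = B≈ i v a
      ...   | no  _      = sym (zeroʳ _)

    module _ (t : Fin n → K) where

      differences-invertible : (∀ i j → t i ≈ t j → i ≡ j) → InvertibleOnPairs (λ i j → t i - t j)
      differences-invertible distinct i j i<j =
        inverse (t i - t j) (λ tᵢ-tⱼ≈0 → <-irrefl (distinct i j (x∙y⁻¹≈ε⇒x≈y _ _ tᵢ-tⱼ≈0)) i<j)

      pairColumn : Fin n → Fn → Row
      pairColumn v f i j = if does (v ≟ i) then f (t j) else (if does (v ≟ j) then - f (t i) else 0#)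

      pairColumn-cong : ∀ v {f h} → (∀ x → f x ≈ h x) → ∀ i j → pairColumn v f i j ≈ pairColumn v h i j
      pairColumn-cong v f≈h i j with v ≟ i
      ... | yes _ = f≈h _
      ... | no  _ with v ≟ j
      ...   | yes _ = -‿cong (f≈h _)
      ...   | no  _ = refl

      pairColumn-+ : ∀ v f h i j →
                     pairColumn v (λ x → f x + h x) i j ≈ pairColumn v f i j + pairColumn v h i j
      pairColumn-+ v f h i j with v ≟ i
      ... | yes _ = refl
      ... | no  _ with v ≟ j
      ...   | yes _ = sym (-‿+-comm _ _)
      ...   | no  _ = sym (+-identityˡ 0#)

      pairColumn-* : ∀ v r f i j → pairColumn v (λ x → r * f x) i j ≈ r * pairColumn v f i j
      pairColumn-* v r f i j with v ≟ i
      ... | yes _ = refl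
      ... | no  _ with v ≟ j
      ...   | yes _ = -‿distribʳ-* r _
      ...   | no  _ = sym (zeroʳ r)

      pairFunctional-linear : ∀ (λc : Row) v → IsLinear (λ f → ΣPairs (λ i j → λc i j * pairColumn v f i j))
      pairFunctional-linear λc v = record
        { cong   = λ f≈h → ΣPairs-cong (λ i j _ → *-congˡ (pairColumn-cong v f≈h i j))
        ; homo-+ = λ f h → trans (ΣPairs-cong (λ i j _ → trans (*-congˡ (pairColumn-+ v f h i j))
                                                                 (distribˡ _ _ _)))
                                 (ΣPairs-+ _ _)
        ; homo-* = λ r f → trans (ΣPairs-cong (λ i j _ → trans (*-congˡ (pairColumn-* v r f i j))
                                                                 (x∙yz≈y∙xz _ r _)))
                                 (ΣPairs-* r _)
        }

      module _ {d : ℕ} where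

        polyMatrix : (Fin n → ℕ → Fn) → PairMatrix ℝ n d
        polyMatrix p = pairMatrix ℝ (λ i j a → p i (toℕ a) (t j)) (λ i j a → - p j (toℕ a) (t i))

        polyMatrix-column : ∀ p i j v a → polyMatrix p i j v a ≈ pairColumn v (p v (toℕ a)) i j
        polyMatrix-column p i j v a with v ≟ i
        ... | yes ≡.refl = refl
        ... | no  _ with v ≟ j
        ...   | yes ≡.refl = refl
        ...   | no  _      = refl

        Independent-changeBasis : ∀ {p p′ S} → (∀ v {a} → a ℕ.< d → Span (p′ v) d (p v a)) →
                                  Independent ℝ n d (polyMatrix p) S → Independent ℝ n d (polyMatrix p′) S
        Independent-changeBasis {p} {p′} p∈p′ ind λc outside dependency = ind λc outside dependency′
          where
          generator-vanishes : ∀ v {b} (b<d : b ℕ.< d) →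
                               ΣPairs (λ i j → λc i j * pairColumn v (p′ v b) i j) ≈ 0#
          generator-vanishes v b<d =
            trans (ΣPairs-cong (λ i j _ → *-congˡ (sym (column-at i j)))) (dependency v (fromℕ< b<d))
            where
            column-at : ∀ i j → polyMatrix p′ i j v (fromℕ< b<d) ≈ pairColumn v (p′ v _) i j
            column-at i j = trans (polyMatrix-column p′ i j v (fromℕ< b<d))
                                  (reflexive (≡.cong (λ k → pairColumn v (p′ v k) i j) (toℕ-fromℕ< b<d)))
          dependency′ : ∀ v a → ΣPairs (λ i j → λc i j * polyMatrix p i j v a) ≈ 0#
          dependency′ v a = trans (ΣPairs-cong (λ i j _ → *-congˡ (polyMatrix-column p i j v a)))
            (vanishes-on-Span (pairFunctional-linear λc v) (generator-vanishes v) (p∈p′ v (toℕ<n a)))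

        SameMatroid-triangularBases : ∀ {p p′} →
                                      (∀ v → TriangularBasis (p v)) → (∀ v → TriangularBasis (p′ v)) →
                                      SameMatroid ℝ n d d (polyMatrix p) (polyMatrix p′)
        SameMatroid-triangularBases B B′ S =
          mk⇔ (Independent-changeBasis (λ v → triangular-span (B v) (B′ v)))
              (Independent-changeBasis (λ v → triangular-span (B′ v) (B v)))

        SameMatroid-scaledBases : ∀ {s s′ p p′ M M′} → InvertibleOnPairs s → InvertibleOnPairs s′ →
          (∀ v → TriangularBasis (p v)) → (∀ v → TriangularBasis (p′ v)) →
          (∀ i j v a → M i j v a ≈ scaleRows s (polyMatrix p) i j v a) →
          (∀ i j v a → M′ i j v a ≈ scaleRows s′ (polyMatrix p′) i j v a) →
          SameMatroid ℝ n d d M M′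
        SameMatroid-scaledBases s-inv s′-inv B B′ M≈ M′≈ =
          SameMatroid-trans (≈⇒SameMatroid (λ i j _ → M≈ i j))
          (SameMatroid-trans (SameMatroid-sym (SameMatroid-scaleRows s-inv))
          (SameMatroid-trans (SameMatroid-triangularBases B B′)
          (SameMatroid-trans (SameMatroid-scaleRows s′-inv)
                             (≈⇒SameMatroid (λ i j _ v a → sym (M′≈ i j v a))))))

        cofactor≈ : ∀ i j v a →
          cofactorMatrix ℝ d t (λ i → pow ℝ (t i) 2) i j v a ≈
          scaleRows (λ i j → pow ℝ (t i - t j) (d ∸ 1)) (polyMatrix (λ v → shifted (t v))) i j v a
        cofactor≈ = pairMatrix-scaled
          (λ i j a → cvec-parabola (t i) (t j) a)
          (λ i j a → trans (-‿cong (cvec-parabola (t i) (t j) a))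
                           (trans (-‿distribʳ-* _ _) (*-congˡ (-‿cong (pow-congˡ (toℕ a) (+-comm _ _))))))

        rigidity≈ : ∀ i j v a →
          rigidityMatrix ℝ (λ i a → pow ℝ (t i) (suc (toℕ a))) i j v a ≈
          scaleRows (λ i j → t i - t j) (polyMatrix (λ v → completeHomogeneous (t v))) i j v a
        rigidity≈ = pairMatrix-scaled
          (λ i j a → pow-difference (t i) (t j) (toℕ a))
          (λ i j a → trans (pow-difference (t j) (t i) (toℕ a))
                           (solve 3 (λ x y h → (y :- x) :* h := (x :- y) :* (:- h))
                                    refl (t i) (t j) (completeHomogeneous (t j) (toℕ a) (t i))))

        hyper₀≈ : ∀ i j v a →
          hyperMatrix ℝ (λ i a → pow ℝ (t i) (toℕ a)) i j v a ≈
          scaleRows (λ _ _ → 1#) (polyMatrix (λ _ → monomial)) i j v a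
        hyper₀≈ = pairMatrix-scaled (λ i j a → sym (*-identityˡ _)) (λ i j a → sym (*-identityˡ _))

        hyper₁≈ : (t-inv : ∀ i → Invertible (t i)) → ∀ i j v a →
          hyperMatrix ℝ (λ i a → pow ℝ (t i) (suc (toℕ a))) i j v a ≈
          scaleRows (λ i j → t i * t j) (polyMatrix (λ v → scaledMonomial (proj₁ (t-inv v)))) i j v a
        hyper₁≈ t-inv = pairMatrix-scaled
          (λ i j a → rescale-by-inverse (proj₂ (t-inv i)) (t j) _)
          (λ i j a → trans (-‿cong (rescale-by-inverse (proj₂ (t-inv j)) (t i) _))
                           (trans (-‿distribʳ-* _ _) (*-congʳ (*-comm (t j) (t i)))))

        SameMatroid-cofactor-rigidity :
          (∀ i j → t i ≈ t j → i ≡ j) →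
          SameMatroid ℝ n d d (cofactorMatrix ℝ d t (λ i → pow ℝ (t i) 2))
                              (rigidityMatrix ℝ (λ i a → pow ℝ (t i) (suc (toℕ a))))
        SameMatroid-cofactor-rigidity distinct = SameMatroid-scaledBases
          (λ i j i<j → invertible-pow (d ∸ 1) (differences-invertible distinct i j i<j))
          (differences-invertible distinct)
          (λ v → shifted-triangular (t v)) (λ v → completeHomogeneous-triangular (t v))
          cofactor≈ rigidity≈

        SameMatroid-rigidity-hyper :
          (∀ i j → t i ≈ t j → i ≡ j) →
          SameMatroid ℝ n d d (rigidityMatrix ℝ (λ i a → pow ℝ (t i) (suc (toℕ a))))
                              (hyperMatrix ℝ (λ i a → pow ℝ (t i) (toℕ a)))
        SameMatroid-rigidity-hyper distinct = SameMatroid-scaledBases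
          (differences-invertible distinct) (λ _ _ _ → invertible-1#)
          (λ v → completeHomogeneous-triangular (t v)) (λ _ → monomial-triangular)
          rigidity≈ hyper₀≈

        SameMatroid-hyper-hyper :
          (∀ i → ¬ (t i ≈ 0#)) →
          SameMatroid ℝ n d d (hyperMatrix ℝ (λ i a → pow ℝ (t i) (toℕ a)))
                              (hyperMatrix ℝ (λ i a → pow ℝ (t i) (suc (toℕ a))))
        SameMatroid-hyper-hyper t≉0 = SameMatroid-scaledBases
          (λ _ _ _ → invertible-1#) (λ i j _ → invertible-* (t-inv i) (t-inv j))
          (λ _ → monomial-triangular) (λ v → scaledMonomial-triangular (proj₂ (t-inv v)))
          hyper₀≈ (hyper₁≈ t-inv)
          where
          t-inv : ∀ i → Invertible (t i)
          t-inv i = inverse (t i) (t≉0 i)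

theorem1p1 : ∀ {c ℓ₁ ℓ₂} (ℝ : CompleteOrderedField c ℓ₁ ℓ₂) →
    (d : ℕ) → 1 ≤ d → (n : ℕ) → (t : Fin n → Carrier ℝ) →
    (∀ i j → eqR ℝ (t i) (t j) → i ≡ j) →
    (SameMatroid ℝ n d d (cofactorMatrix ℝ d t (λ i → pow ℝ (t i) 2))
                   (rigidityMatrix ℝ (λ i a → pow ℝ (t i) (suc (toℕ a)))))
    × (SameMatroid ℝ n d d (rigidityMatrix ℝ (λ i a → pow ℝ (t i) (suc (toℕ a))))
                     (hyperMatrix ℝ (λ i a → pow ℝ (t i) (toℕ a))))
    × ((∀ i → ¬ (eqR ℝ (t i) (zeroR ℝ))) →
       SameMatroid ℝ n d d (hyperMatrix ℝ (λ i a → pow ℝ (t i) (toℕ a)))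
                     (hyperMatrix ℝ (λ i a → pow ℝ (t i) (suc (toℕ a)))))
theorem1p1 ℝ d _ n t distinct =
    SameMatroid-cofactor-rigidity t distinct
  , SameMatroid-rigidity-hyper t distinct
  , SameMatroid-hyper-hyper t
  where open MomentCurve ℝ
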